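{- Let $q$ be a prime power and $v$ a positive integer. Let $\mathcal{P}$ be a vector space partition of $\mathbb{F}_q^v$ of type $d_l^{u_l}\ldots d_2^{u_2}d_1^{u_1}$, where $d_l>\dots>d_2>d_1\ge 1$ and $u_1,u_2>0$, and let $\mathcal{N}$ be the set of $d_1$-dimensional elements of $\mathcal{P}$. Then for every hyperplane $H$ of $\mathbb{F}_q^v$ we have $\#\mathcal{N}\equiv \#(\mathcal{N}\cap H)\pmod{q^{d_2-d_1}}$, where $\#(\mathcal{N}\cap H):=\#\{U\in\mathcal{N}: U\le H\}$.
   Context: A vector space partition of $\mathbb{F}_q^v$ is a collection $\mathcal{P}$ of (non-zero) subspaces such that every non-zero vector of $\mathbb{F}_q^v$ lies in exactly one element of $\mathcal{P}$. It has type $d_l^{u_l}\ldots d_1^{u_1}$ if it contains exactly $u_j$ subspaces of dimension $d_j$ for each $j$ and no subspaces of other dimensions. A hyperplane is a $(v-1)$-dimensional subspace. -}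

module Defs where

open import Level using (0ℓ)
open import Data.Nat using (ℕ; zero; suc; _≤_)
open import Data.Fin using (Fin)
open import Data.Fin.Properties using (any?; all?)
open import Data.Vec using (Vec; []; _∷_; zipWith; replicate)
open import Data.Vec.Properties using (≡-dec)
open import Data.List using (List; length; filter; lookup)
open import Data.Product using (Σ; ∃; _×_; _,_; proj₁; proj₂)
open import Function.Bundles using (_↔_; Inverse)
open import Relation.Nullary using (¬_; Dec; yes; no)
open import Relation.Nullary.Decidable using (map′)
open import Relation.Unary using (Pred; Decidable)
open import Relation.Binary.PropositionalEquality using (_≡_; _≢_; refl; sym; cong; subst)
open import Algebra.Structures using (IsCommutativeRing)

-- A finite field with exactly q elements (so q is necessarily a prime power).
-- Equality of field elements is propositional equality.
record FiniteField (q : ℕ) : Set₁ where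
  infixl 6 _+_
  infixl 7 _*_
  field
    Carrier : Set
    _+_ _*_ : Carrier → Carrier → Carrier
    -_ : Carrier → Carrier
    0# 1# : Carrier
    isCommutativeRing : IsCommutativeRing _≡_ _+_ _*_ -_ 0# 1#
    0≢1 : 0# ≢ 1#
    inverse : ∀ x → x ≢ 0# → ∃ λ y → x * y ≡ 1#
    enum : Fin q ↔ Carrier

module VectorSpace {q : ℕ} (𝔽 : FiniteField q) where
  open FiniteField 𝔽

  Vector : ℕ → Set
  Vector v = Vec Carrier v

  zeroV : ∀ {v} → Vector v
  zeroV = replicate _ 0#

  _⊕_ : ∀ {v} → Vector v → Vector v → Vector v
  _⊕_ = zipWith _+_

  _·_ : ∀ {v} → Carrier → Vector v → Vector v
  a · x = Data.Vec.map (a *_) x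

  lincomb : ∀ {v d} → Vec Carrier d → Vec (Vector v) d → Vector v
  lincomb [] [] = zeroV
  lincomb (c ∷ cs) (b ∷ bs) = (c · b) ⊕ lincomb cs bs

  LinIndep : ∀ {v d} → Vec (Vector v) d → Set
  LinIndep {d = d} B = ∀ c → lincomb c B ≡ zeroV → c ≡ replicate d 0#

  record Subspace (v : ℕ) : Set where
    constructor subspace
    field
      dim   : ℕ
      basis : Vec (Vector v) dim
      indep : LinIndep basis
  open Subspace public

  _∈ₛ_ : ∀ {v} → Vector v → Subspace v → Set
  x ∈ₛ U = Σ (Vec Carrier (dim U)) λ c → lincomb c (basis U) ≡ x

  _≤ₛ_ : ∀ {v} → Subspace v → Subspace v → Set
  U ≤ₛ W = ∀ x → x ∈ₛ U → x ∈ₛ W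

  IsHyperplane : ∀ {v} → Subspace v → Set
  IsHyperplane {v} H = suc (dim H) ≡ v

  -- vector space partition: a collection (list) of non-zero subspaces such that every
  -- non-zero vector lies in exactly one element (exactly one position of the list).
  IsVSP : ∀ {v} → List (Subspace v) → Set
  IsVSP {v} P =
      (∀ i → 1 ≤ dim (lookup P i))
    × (∀ (x : Vector v) → x ≢ zeroV →
         Σ (Fin (length P)) λ i → x ∈ₛ lookup P i × (∀ j → x ∈ₛ lookup P j → j ≡ i))

  _≟F_ : (x y : Carrier) → Dec (x ≡ y)
  x ≟F y = map′ (λ e → subst₂' e) (cong from) (Data.Fin._≟_ (from x) (from y))
    where
      open Inverse enum
      subst₂' : from x ≡ from y → x ≡ y
      subst₂' e = subst (λ z → z ≡ y) (strictlyInverseˡ x)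
                    (subst (λ z → to (from x) ≡ z) (strictlyInverseˡ y) (cong to e))

  anyF? : {P : Pred Carrier 0ℓ} → Decidable P → Dec (Σ Carrier P)
  anyF? {P} P? = map′ (λ (i , p) → to i , p)
                      (λ (x , p) → from x , subst P (sym (strictlyInverseˡ x)) p)
                      (any? (λ i → P? (to i)))
    where open Inverse enum

  allF? : {P : Pred Carrier 0ℓ} → Decidable P → Dec (∀ x → P x)
  allF? {P} P? = map′ (λ h x → subst P (strictlyInverseˡ x) (h (from x)))
                      (λ h i → h (to i))
                      (all? (λ i → P? (to i)))
    where open Inverse enum

  anyV? : ∀ d {P : Pred (Vec Carrier d) 0ℓ} → Decidable P → Dec (Σ (Vec Carrier d) P)
  anyV? zero P? with P? []
  ... | yes p = yes ([] , p)
  ... | no ¬p = no λ { ([] , p) → ¬p p }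
  anyV? (suc d) {P} P? =
    map′ (λ (a , as , p) → (a ∷ as) , p) (λ { ((a ∷ as) , p) → a , as , p })
         (anyF? (λ a → anyV? d (λ as → P? (a ∷ as))))

  allV? : ∀ d {P : Pred (Vec Carrier d) 0ℓ} → Decidable P → Dec (∀ c → P c)
  allV? zero P? with P? []
  ... | yes p = yes λ { [] → p }
  ... | no ¬p = no λ h → ¬p (h [])
  allV? (suc d) {P} P? =
    map′ (λ h → λ { (a ∷ as) → h a as }) (λ h a as → h (a ∷ as))
         (allF? (λ a → allV? d (λ as → P? (a ∷ as))))

  _∈ₛ?_ : ∀ {v} (x : Vector v) (U : Subspace v) → Dec (x ∈ₛ U)
  x ∈ₛ? U = anyV? (dim U) (λ c → ≡-dec _≟F_ (lincomb c (basis U)) x)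

  _≤ₛ?_ : ∀ {v} (U W : Subspace v) → Dec (U ≤ₛ W)
  U ≤ₛ? W =
    map′ (λ h x (c , e) → subst (_∈ₛ W) e (h c)) (λ h c → h _ (c , refl))
         (allV? (dim U) (λ c → lincomb c (basis U) ∈ₛ? W))

  countDim : ∀ {v} → List (Subspace v) → ℕ → ℕ
  countDim P d = length (filter (λ U → Data.Nat._≟_ (dim U) d) P)

  countDimIn : ∀ {v} → List (Subspace v) → ℕ → Subspace v → ℕ
  countDimIn P d H =
    length (filter (λ U → Relation.Nullary._×-dec_ (Data.Nat._≟_ (dim U) d) (U ≤ₛ? H)) P)

module Submission where

-- Every vector outside H
-- lies in exactly one U ∈ P, and for U ∈ P
--     |U \ H| = (q-1)·q^(dim U - 1)  if U ⊄ H,      |U \ H| = 0  if U ≤ H,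
-- while |F_q^v \ H| = (q-1)·q^(v-1).  Double counting the vectors outside H thus gives
--     q^(v-1) = Σ_{U ∈ P, U ⊄ H} q^(dim U - 1).
-- Every element of P has dimension d₁ or at least d₂ ≤ v, so all terms except those of the
-- N elements of dimension d₁ not contained in H are divisible by q^(d₂-1), as is q^(v-1).
-- Hence q^(d₂-1) ∣ N·q^(d₁-1), i.e. q^(d₂-d₁) ∣ N = #𝒩 - #(𝒩 ∩ H).

open import Defs
open import Level using (0ℓ)
open import Data.Nat using (ℕ; zero; suc; _<_; _≤_; _^_; _∸_; _+_; _*_; z≤n; s≤s; NonZero)
import Data.Nat as ℕ
open import Data.Nat.Properties
open import Data.Fin using (Fin; zero; suc)
import Data.Fin as Fin
open import Data.Fin.Properties using () renaming (suc-injective to Fin-suc-injective; 0≢1+n to Fin-0≢1+n)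
open import Data.List using (List; []; _∷_; length; lookup; map; filter; _++_; allFin)
open import Data.List.Properties using (length-map; length-tabulate; map-tabulate)
open import Data.List.Membership.Propositional using (_∈_)
open import Data.List.Relation.Unary.Any using (here; there)
open import Data.List.Relation.Unary.All using (All; []; _∷_)
import Data.List.Relation.Unary.All as All
open import Data.List.Relation.Unary.All.Properties using (all-filter)
open import Data.Vec using (Vec; []; _∷_)
import Data.Vec as Vec
open import Data.Vec.Properties
  using (≡-dec; ∷-injective; zipWith-assoc; zipWith-comm; zipWith-identityˡ; zipWith-identityʳ;
         zipWith-inverseˡ; zipWith-inverseʳ; map-cong)
open import Data.Product using (∃; _×_; _,_; proj₁; proj₂)
open import Data.Empty using (⊥-elim)
open import Function.Base using (id)
open import Function.Bundles using (Inverse)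
open import Relation.Nullary using (¬_; Dec; yes; no; _×-dec_)
open import Relation.Nullary.Decidable using (¬?; decidable-stable)
open import Relation.Binary.Definitions using (DecidableEquality)
open import Relation.Binary.PropositionalEquality
  using (_≡_; _≢_; refl; sym; trans; cong; cong₂; subst; subst₂; isEquivalence; module ≡-Reasoning)
open import Algebra.Bundles using (AbelianGroup; CommutativeRing; Ring)
open import Algebra.Structures using (IsCommutativeRing)
import Algebra.Properties.Ring as RingProperties
import Algebra.Properties.Group as GroupProperties
import Algebra.Properties.CommutativeSemigroup as CommSemigroupProperties
import Data.Integer as ℤ
import Data.Integer.Properties as ℤₚ

ind : {P : Set} → Dec P → ℕ
ind (yes _) = 1
ind (no _)  = 0

ind-cong : {P Q : Set} (p : Dec P) (q : Dec Q) → (P → Q) → (Q → P) → ind p ≡ ind q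
ind-cong (yes _) (yes _) _ _ = refl
ind-cong (yes x) (no ¬y) f _ = ⊥-elim (¬y (f x))
ind-cong (no ¬x) (yes y) _ g = ⊥-elim (¬x (g y))
ind-cong (no _)  (no _)  _ _ = refl

ind-× : {P Q : Set} (p : Dec P) (q : Dec Q) → ind (p ×-dec q) ≡ ind p * ind q
ind-× (yes _) (yes _) = refl
ind-× (yes _) (no _)  = refl
ind-× (no _)  (yes _) = refl
ind-× (no _)  (no _)  = refl

ind-split : {P Q : Set} (p : Dec P) (q : Dec Q) → ind p ≡ ind (p ×-dec q) + ind (p ×-dec ¬? q)
ind-split (yes _) (yes _) = refl
ind-split (yes _) (no _)  = refl
ind-split (no _)  (yes _) = refl
ind-split (no _)  (no _)  = refl

ind-compl : {P : Set} (p : Dec P) → ind p + ind (¬? p) ≡ 1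
ind-compl (yes _) = refl
ind-compl (no _)  = refl

ind-no : {P : Set} (p : Dec P) → ¬ P → ind p ≡ 0
ind-no (yes x) ¬x = ⊥-elim (¬x x)
ind-no (no _)  _  = refl

ind-yes : {P : Set} (p : Dec P) → P → ind p ≡ 1
ind-yes (yes _)  _ = refl
ind-yes (no ¬x) x = ⊥-elim (¬x x)

ind≤1 : {P : Set} (p : Dec P) → ind p ≤ 1
ind≤1 (yes _) = s≤s z≤n
ind≤1 (no _)  = z≤n

module _ {A : Set} where

  Σl : (A → ℕ) → List A → ℕ
  Σl f []       = 0
  Σl f (x ∷ xs) = f x + Σl f xs

  Σl-cong : {f g : A → ℕ} (xs : List A) → (∀ x → f x ≡ g x) → Σl f xs ≡ Σl g xs
  Σl-cong []       f≗g = refl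
  Σl-cong (x ∷ xs) f≗g = cong₂ _+_ (f≗g x) (Σl-cong xs f≗g)

  Σl-cong-on : {f g : A → ℕ} (xs : List A) →
               (∀ i → f (lookup xs i) ≡ g (lookup xs i)) → Σl f xs ≡ Σl g xs
  Σl-cong-on []       f≗g = refl
  Σl-cong-on (x ∷ xs) f≗g = cong₂ _+_ (f≗g zero) (Σl-cong-on xs (λ i → f≗g (suc i)))

  Σl-+ : (f g : A → ℕ) (xs : List A) → Σl (λ x → f x + g x) xs ≡ Σl f xs + Σl g xs
  Σl-+ f g []       = refl
  Σl-+ f g (x ∷ xs) = trans (cong (f x + g x +_) (Σl-+ f g xs))
                            (interchange (f x) (g x) (Σl f xs) (Σl g xs))
    where open CommSemigroupProperties +-commutativeSemigroup using (interchange)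

  Σl-*ˡ : (c : ℕ) (f : A → ℕ) (xs : List A) → Σl (λ x → c * f x) xs ≡ c * Σl f xs
  Σl-*ˡ c f []       = sym (*-zeroʳ c)
  Σl-*ˡ c f (x ∷ xs) =
    trans (cong (c * f x +_) (Σl-*ˡ c f xs)) (sym (*-distribˡ-+ c (f x) (Σl f xs)))

  Σl-*ʳ : (c : ℕ) (f : A → ℕ) (xs : List A) → Σl (λ x → f x * c) xs ≡ Σl f xs * c
  Σl-*ʳ c f xs = trans (Σl-cong xs (λ x → *-comm (f x) c)) (trans (Σl-*ˡ c f xs) (*-comm c _))

  Σl-0 : (f : A → ℕ) (xs : List A) → (∀ x → f x ≡ 0) → Σl f xs ≡ 0
  Σl-0 f []       f≗0 = refl
  Σl-0 f (x ∷ xs) f≗0 = cong₂ _+_ (f≗0 x) (Σl-0 f xs f≗0)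

  Σl-0-on : {f : A → ℕ} (xs : List A) → (∀ i → f (lookup xs i) ≡ 0) → Σl f xs ≡ 0
  Σl-0-on xs f≗0 = trans (Σl-cong-on xs f≗0) (Σl-0 (λ _ → 0) xs (λ _ → refl))

  Σl-const : (c : ℕ) (xs : List A) → Σl (λ _ → c) xs ≡ length xs * c
  Σl-const c []       = refl
  Σl-const c (x ∷ xs) = cong (c +_) (Σl-const c xs)

  Σl-1 : (xs : List A) → Σl (λ _ → 1) xs ≡ length xs
  Σl-1 xs = trans (Σl-const 1 xs) (*-identityʳ _)

  Σl-++ : (f : A → ℕ) (xs ys : List A) → Σl f (xs ++ ys) ≡ Σl f xs + Σl f ys
  Σl-++ f []       ys = refl
  Σl-++ f (x ∷ xs) ys = trans (cong (f x +_) (Σl-++ f xs ys)) (sym (+-assoc (f x) _ _))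

  Σl-ind≤ : {P : A → Set} (P? : ∀ x → Dec (P x)) (xs : List A) →
            Σl (λ x → ind (P? x)) xs ≤ length xs
  Σl-ind≤ P? []       = z≤n
  Σl-ind≤ P? (x ∷ xs) = +-mono-≤ (ind≤1 (P? x)) (Σl-ind≤ P? xs)

  Σl-ind-full : {P : A → Set} (P? : ∀ x → Dec (P x)) (xs : List A) →
                Σl (λ x → ind (P? x)) xs ≡ length xs → All P xs
  Σl-ind-full P? []       _ = []
  Σl-ind-full P? (x ∷ xs) e with P? x
  ... | yes px = px ∷ Σl-ind-full P? xs (suc-injective e)
  ... | no _   = ⊥-elim (<⇒≱ (s≤s ≤-refl) (subst (_≤ length xs) e (Σl-ind≤ P? xs)))

  length-filter≡Σl : {P : A → Set} (P? : ∀ x → Dec (P x)) (xs : List A) →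
                     length (filter P? xs) ≡ Σl (λ x → ind (P? x)) xs
  length-filter≡Σl P? []       = refl
  length-filter≡Σl P? (x ∷ xs) with P? x
  ... | yes _ = cong suc (length-filter≡Σl P? xs)
  ... | no _  = length-filter≡Σl P? xs

  count-unique-position : {Q : A → Set} (Q? : ∀ x → Dec (Q x)) (xs : List A) (i : Fin (length xs)) →
                          Q (lookup xs i) → (∀ j → Q (lookup xs j) → j ≡ i) →
                          Σl (λ x → ind (Q? x)) xs ≡ 1
  count-unique-position Q? (x ∷ xs) zero Qx only-zero =
    cong₂ _+_ (ind-yes (Q? x) Qx) (Σl-0-on xs not-later)
    where
      not-later : ∀ j → ind (Q? (lookup xs j)) ≡ 0
      not-later j = ind-no (Q? (lookup xs j)) (λ Qxj → Fin-0≢1+n (sym (only-zero (suc j) Qxj)))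
  count-unique-position {Q} Q? (x ∷ xs) (suc i) Qxi only-i =
    cong₂ _+_ (ind-no (Q? x) ¬Qx) (count-unique-position Q? xs i Qxi only-i')
    where
      ¬Qx : ¬ Q x
      ¬Qx Qx = Fin-0≢1+n (only-i zero Qx)
      only-i' : ∀ j → Q (lookup xs j) → j ≡ i
      only-i' j Qxj = Fin-suc-injective (only-i (suc j) Qxj)

module _ {A B : Set} where

  Σl-map : (f : B → ℕ) (g : A → B) (xs : List A) → Σl f (map g xs) ≡ Σl (λ x → f (g x)) xs
  Σl-map f g []       = refl
  Σl-map f g (x ∷ xs) = cong (f (g x) +_) (Σl-map f g xs)

  Σl-swap : (f : A → B → ℕ) (xs : List A) (ys : List B) →
            Σl (λ x → Σl (f x) ys) xs ≡ Σl (λ y → Σl (λ x → f x y) xs) ys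
  Σl-swap f []       ys = sym (Σl-0 _ ys (λ _ → refl))
  Σl-swap f (x ∷ xs) ys = trans (cong (Σl (f x) ys +_) (Σl-swap f xs ys))
                                (sym (Σl-+ (f x) (λ y → Σl (λ x' → f x' y) xs) ys))

  bind : (A → List B) → List A → List B
  bind g []       = []
  bind g (x ∷ xs) = g x ++ bind g xs

  Σl-bind : (f : B → ℕ) (g : A → List B) (xs : List A) →
            Σl f (bind g xs) ≡ Σl (λ x → Σl f (g x)) xs
  Σl-bind f g []       = refl
  Σl-bind f g (x ∷ xs) = trans (Σl-++ f (g x) (bind g xs)) (cong (Σl f (g x) +_) (Σl-bind f g xs))

module Enumeration {A : Set} (_≟_ : DecidableEquality A) where

  IsEnum : List A → Set
  IsEnum xs = ∀ a → Σl (λ x → ind (x ≟ a)) xs ≡ 1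

  module _ {xs : List A} (E : IsEnum xs) where

    enum-∈ : ∀ a → a ∈ xs
    enum-∈ a = occurs xs (E a)
      where
        occurs : ∀ ys → Σl (λ x → ind (x ≟ a)) ys ≡ 1 → a ∈ ys
        occurs (y ∷ ys) e with y ≟ a
        ... | yes y≡a = here (sym y≡a)
        ... | no _    = there (occurs ys e)

    full⇒all : {P : A → Set} (P? : ∀ x → Dec (P x)) →
               Σl (λ x → ind (P? x)) xs ≡ length xs → ∀ a → P a
    full⇒all P? e a = All.lookup (Σl-ind-full P? xs e) (enum-∈ a)

    count-unique : {Q : A → Set} (Q? : ∀ x → Dec (Q x)) (c₀ : A) →
                   (∀ c → Q c → c ≡ c₀) → Q c₀ → Σl (λ x → ind (Q? x)) xs ≡ 1
    count-unique Q? c₀ unique q₀ =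
      trans (Σl-cong xs (λ c → ind-cong (Q? c) (c ≟ c₀) (unique c) (λ { refl → q₀ }))) (E c₀)

    Σl-point : (a : A) (f : A → ℕ) → Σl (λ x → ind (x ≟ a) * f x) xs ≡ f a
    Σl-point a f = begin
        Σl (λ x → ind (x ≟ a) * f x) xs ≡⟨ Σl-cong xs at-a ⟩
        Σl (λ x → ind (x ≟ a) * f a) xs ≡⟨ Σl-*ʳ (f a) _ xs ⟩
        Σl (λ x → ind (x ≟ a)) xs * f a ≡⟨ cong (_* f a) (E a) ⟩
        1 * f a                         ≡⟨ *-identityˡ (f a) ⟩
        f a                             ∎
      where
        open ≡-Reasoning
        at-a : ∀ x → ind (x ≟ a) * f x ≡ ind (x ≟ a) * f a
        at-a x with x ≟ a
        ... | yes refl = refl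
        ... | no _     = refl

    reindex : (τ σ : A → A) → (∀ x → τ (σ x) ≡ x) → (∀ y → σ (τ y) ≡ y) →
              (f : A → ℕ) → Σl f xs ≡ Σl (λ y → f (τ y)) xs
    reindex τ σ τσ στ f = begin
        Σl f xs
          ≡⟨ Σl-cong xs (λ x → sym (trans (cong (_* f x) (one-preimage x)) (*-identityˡ (f x)))) ⟩
        Σl (λ x → Σl (λ y → ind (τ y ≟ x)) xs * f x) xs
          ≡⟨ Σl-cong xs (λ x → sym (Σl-*ʳ (f x) _ xs)) ⟩
        Σl (λ x → Σl (λ y → ind (τ y ≟ x) * f x) xs) xs
          ≡⟨ Σl-swap (λ x y → ind (τ y ≟ x) * f x) xs xs ⟩
        Σl (λ y → Σl (λ x → ind (τ y ≟ x) * f x) xs) xs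
          ≡⟨ Σl-cong xs (λ y → trans (Σl-cong xs (λ x → cong (_* f x)
               (ind-cong (τ y ≟ x) (x ≟ τ y) sym sym))) (Σl-point (τ y) f)) ⟩
        Σl (λ y → f (τ y)) xs ∎
      where
        open ≡-Reasoning
        one-preimage : ∀ x → Σl (λ y → ind (τ y ≟ x)) xs ≡ 1
        one-preimage x = count-unique (λ y → τ y ≟ x) (σ x) (λ { c refl → sym (στ c) }) (τσ x)

open Enumeration using (IsEnum)

image-count : {A B : Set} (_≟A_ : DecidableEquality A) (_≟B_ : DecidableEquality B)
              {xs : List A} {ys : List B} → IsEnum _≟A_ xs → IsEnum _≟B_ ys →
              (f : B → A) → (∀ c c' → f c ≡ f c' → c ≡ c') →
              {P : A → Set} (P? : ∀ x → Dec (P x)) →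
              (∀ x → P x → ∃ λ c → f c ≡ x) → (∀ c → P (f c)) →
              Σl (λ x → ind (P? x)) xs ≡ length ys
image-count _≟A_ _≟B_ {xs} {ys} EA EB f injective P? P⇒image image⇒P = begin
    Σl (λ x → ind (P? x)) xs                   ≡⟨ Σl-cong xs preimages ⟩
    Σl (λ x → Σl (λ c → ind (f c ≟A x)) ys) xs ≡⟨ Σl-swap _ xs ys ⟩
    Σl (λ c → Σl (λ x → ind (f c ≟A x)) xs) ys
      ≡⟨ Σl-cong ys (λ c → trans (Σl-cong xs (λ x → ind-cong (f c ≟A x) (x ≟A f c) sym sym))
                                 (EA (f c))) ⟩
    Σl (λ _ → 1) ys                            ≡⟨ Σl-1 ys ⟩
    length ys                                  ∎
  where
    open ≡-Reasoning
    preimages : ∀ x → ind (P? x) ≡ Σl (λ c → ind (f c ≟A x)) ys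
    preimages x with P? x
    ... | yes px = let (c₀ , fc₀≡x) = P⇒image x px in
          sym (Enumeration.count-unique _≟B_ {ys} EB (λ c → f c ≟A x) c₀
                 (λ c fc≡x → injective c c₀ (trans fc≡x (sym fc₀≡x))) fc₀≡x)
    ... | no ¬px = sym (Σl-0 _ ys no-preimage)
      where
        no-preimage : ∀ c → ind (f c ≟A x) ≡ 0
        no-preimage c = ind-no (f c ≟A x) (λ { refl → ¬px (image⇒P c) })

allFin-enum : ∀ n → IsEnum Fin._≟_ (allFin n)
allFin-enum (suc n) a =
  trans (cong (λ ys → ind (zero Fin.≟ a) + Σl (λ i → ind (i Fin.≟ a)) ys) (sym (map-tabulate id suc)))
        (trans (cong (ind (zero Fin.≟ a) +_) (Σl-map _ suc (allFin n))) (tail-count a))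
  where
    tail-count : ∀ a → ind (zero Fin.≟ a) + Σl (λ i → ind (suc i Fin.≟ a)) (allFin n) ≡ 1
    tail-count zero    = cong suc (Σl-0 _ (allFin n) (λ _ → refl))
    tail-count (suc j) = trans (Σl-cong (allFin n) (λ i → ind-cong (suc i Fin.≟ suc j) (i Fin.≟ j)
                                 Fin-suc-injective (cong suc)))
                               (allFin-enum n j)

module VectorEnumeration {q : ℕ} (𝔽 : FiniteField q) where
  open FiniteField 𝔽 using (Carrier; enum)
  open VectorSpace 𝔽
  open Inverse enum using (to; from; strictlyInverseˡ; strictlyInverseʳ)

  fieldElements : List Carrier
  fieldElements = map to (allFin q)

  fieldElements-length : length fieldElements ≡ q
  fieldElements-length = trans (length-map to (allFin q)) (length-tabulate id)

  fieldElements-enum : IsEnum _≟F_ fieldElements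
  fieldElements-enum a = trans (Σl-map _ to (allFin q))
    (trans (Σl-cong (allFin q) (λ i → ind-cong (to i ≟F a) (i Fin.≟ from a)
              (λ e → trans (sym (strictlyInverseʳ i)) (cong from e))
              (λ e → trans (cong to e) (strictlyInverseˡ a))))
           (allFin-enum q (from a)))

  _≟V_ : ∀ {v} → DecidableEquality (Vector v)
  _≟V_ = ≡-dec _≟F_

  vectors : ∀ v → List (Vector v)
  vectors zero    = [] ∷ []
  vectors (suc v) = bind (λ a → map (a ∷_) (vectors v)) fieldElements

  vectors-length : ∀ v → length (vectors v) ≡ q ^ v
  vectors-length zero    = refl
  vectors-length (suc v) = begin
      length (vectors (suc v))                                   ≡⟨ sym (Σl-1 (vectors (suc v))) ⟩
      Σl (λ _ → 1) (vectors (suc v))                             ≡⟨ Σl-bind _ _ fieldElements ⟩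
      Σl (λ a → Σl (λ _ → 1) (map (a ∷_) (vectors v))) fieldElements
        ≡⟨ Σl-cong fieldElements (λ a → trans (Σl-1 (map (a ∷_) (vectors v)))
                                 (trans (length-map _ (vectors v)) (vectors-length v))) ⟩
      Σl (λ _ → q ^ v) fieldElements                             ≡⟨ Σl-const _ fieldElements ⟩
      length fieldElements * q ^ v                               ≡⟨ cong (_* q ^ v) fieldElements-length ⟩
      q * q ^ v                                                  ∎
    where open ≡-Reasoning

  vectors-enum : ∀ v → IsEnum _≟V_ (vectors v)
  vectors-enum zero    [] = refl
  vectors-enum (suc v) (b ∷ bs) = begin
      Σl (λ x → ind (x ≟V (b ∷ bs))) (vectors (suc v))
        ≡⟨ Σl-bind _ _ fieldElements ⟩
      Σl (λ a → Σl (λ x → ind (x ≟V (b ∷ bs))) (map (a ∷_) (vectors v))) fieldElements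
        ≡⟨ Σl-cong fieldElements (λ a → Σl-map _ (a ∷_) (vectors v)) ⟩
      Σl (λ a → Σl (λ xs → ind ((a ∷ xs) ≟V (b ∷ bs))) (vectors v)) fieldElements
        ≡⟨ Σl-cong fieldElements (λ a → Σl-cong (vectors v) (λ xs → split-head a xs)) ⟩
      Σl (λ a → Σl (λ xs → ind (a ≟F b) * ind (xs ≟V bs)) (vectors v)) fieldElements
        ≡⟨ Σl-cong fieldElements (λ a → trans (Σl-*ˡ (ind (a ≟F b)) _ (vectors v))
                                              (cong (ind (a ≟F b) *_) (vectors-enum v bs))) ⟩
      Σl (λ a → ind (a ≟F b) * 1) fieldElements
        ≡⟨ Enumeration.Σl-point _≟F_ {fieldElements} fieldElements-enum b (λ _ → 1) ⟩
      1 ∎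
    where
      open ≡-Reasoning
      split-head : ∀ a xs → ind ((a ∷ xs) ≟V (b ∷ bs)) ≡ ind (a ≟F b) * ind (xs ≟V bs)
      split-head a xs = trans (ind-cong ((a ∷ xs) ≟V (b ∷ bs)) ((a ≟F b) ×-dec (xs ≟V bs))
                                        ∷-injective (λ (e , e') → cong₂ _∷_ e e'))
                              (ind-× (a ≟F b) (xs ≟V bs))

module LinearAlgebra {q : ℕ} (𝔽 : FiniteField q) where
  open FiniteField 𝔽 using (Carrier; 0#; 1#; -_; isCommutativeRing)
    renaming (_+_ to _+ᶠ_; _*_ to _*ᶠ_)
  open VectorSpace 𝔽
  private
    module F = IsCommutativeRing isCommutativeRing

  ⊖_ : ∀ {v} → Vector v → Vector v
  ⊖_ = Vec.map -_

  vectorGroup : ℕ → AbelianGroup 0ℓ 0ℓ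
  vectorGroup v = record
    { _≈_ = _≡_ ; _∙_ = _⊕_ {v} ; ε = zeroV ; _⁻¹ = ⊖_
    ; isAbelianGroup = record
      { isGroup = record
        { isMonoid = record
          { isSemigroup = record
            { isMagma = record { isEquivalence = isEquivalence ; ∙-cong = cong₂ _⊕_ }
            ; assoc = zipWith-assoc F.+-assoc }
          ; identity = zipWith-identityˡ F.+-identityˡ , zipWith-identityʳ F.+-identityʳ }
        ; inverse = zipWith-inverseˡ F.-‿inverseˡ , zipWith-inverseʳ F.-‿inverseʳ
        ; ⁻¹-cong = cong ⊖_ }
      ; comm = zipWith-comm F.+-comm } }

  module _ {v : ℕ} where
    open AbelianGroup (vectorGroup v) public
      using () renaming (comm to ⊕-comm; identityˡ to ⊕-identityˡ; _-_ to _⊝_)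
    open GroupProperties (AbelianGroup.group (vectorGroup v))
      using (x∙y⁻¹≈ε⇒x≈y; //-rightDividesˡ; //-rightDividesʳ)
    open CommSemigroupProperties (AbelianGroup.commutativeSemigroup (vectorGroup v))
      using (interchange)

    ⊝-⊕-cancel : (x y : Vector v) → (x ⊝ y) ⊕ y ≡ x
    ⊝-⊕-cancel x y = //-rightDividesˡ y x

    ⊕-⊝-cancel : (x y : Vector v) → (x ⊕ y) ⊝ y ≡ x
    ⊕-⊝-cancel x y = //-rightDividesʳ y x

    ⊝-self : (x : Vector v) → x ⊝ x ≡ zeroV
    ⊝-self = AbelianGroup.inverseʳ (vectorGroup v)

    ⊝≡0⇒≡ : (x y : Vector v) → x ⊝ y ≡ zeroV → x ≡ y
    ⊝≡0⇒≡ = x∙y⁻¹≈ε⇒x≈y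

    ⊕-interchange : (a b c d : Vector v) → (a ⊕ b) ⊕ (c ⊕ d) ≡ (a ⊕ c) ⊕ (b ⊕ d)
    ⊕-interchange = interchange

  ·-distribˡ : ∀ {v} a (x y : Vector v) → a · (x ⊕ y) ≡ (a · x) ⊕ (a · y)
  ·-distribˡ a []      []      = refl
  ·-distribˡ a (b ∷ x) (c ∷ y) = cong₂ _∷_ (F.distribˡ a b c) (·-distribˡ a x y)

  ·-distribʳ : ∀ {v} a b (x : Vector v) → (a +ᶠ b) · x ≡ (a · x) ⊕ (b · x)
  ·-distribʳ a b []      = refl
  ·-distribʳ a b (c ∷ x) = cong₂ _∷_ (F.distribʳ c a b) (·-distribʳ a b x)

  ·-assoc : ∀ {v} a b (x : Vector v) → a · (b · x) ≡ (a *ᶠ b) · x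
  ·-assoc a b []      = refl
  ·-assoc a b (c ∷ x) = cong₂ _∷_ (sym (F.*-assoc a b c)) (·-assoc a b x)

  ·-identity : ∀ {v} (x : Vector v) → 1# · x ≡ x
  ·-identity []      = refl
  ·-identity (c ∷ x) = cong₂ _∷_ (F.*-identityˡ c) (·-identity x)

  ·-zeroˡ : ∀ {v} (x : Vector v) → 0# · x ≡ zeroV
  ·-zeroˡ []      = refl
  ·-zeroˡ (c ∷ x) = cong₂ _∷_ (F.zeroˡ c) (·-zeroˡ x)

  ·-zeroʳ : ∀ {v} a → a · zeroV {v} ≡ zeroV
  ·-zeroʳ {zero}  a = refl
  ·-zeroʳ {suc v} a = cong₂ _∷_ (F.zeroʳ a) (·-zeroʳ a)

  ⊖≡-1· : ∀ {v} (x : Vector v) → ⊖ x ≡ (- 1#) · x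
  ⊖≡-1· = map-cong (λ a → sym (RingProperties.-1*x≈-x ring a))
    where
      ring : Ring 0ℓ 0ℓ
      ring = CommutativeRing.ring (record { isCommutativeRing = isCommutativeRing })

  lincomb-zero : ∀ {v d} (B : Vec (Vector v) d) → lincomb zeroV B ≡ zeroV
  lincomb-zero []      = refl
  lincomb-zero (b ∷ B) = trans (cong₂ _⊕_ (·-zeroˡ b) (lincomb-zero B)) (⊕-identityˡ zeroV)

  lincomb-⊕ : ∀ {v d} (c c' : Vec Carrier d) (B : Vec (Vector v) d) →
              lincomb (c ⊕ c') B ≡ lincomb c B ⊕ lincomb c' B
  lincomb-⊕ []       []         []      = sym (⊕-identityˡ zeroV)
  lincomb-⊕ (a ∷ c) (a' ∷ c') (b ∷ B) =
    trans (cong₂ _⊕_ (·-distribʳ a a' b) (lincomb-⊕ c c' B)) (⊕-interchange (a · b) (a' · b) _ _)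

  lincomb-· : ∀ {v d} a (c : Vec Carrier d) (B : Vec (Vector v) d) →
              lincomb (a · c) B ≡ a · lincomb c B
  lincomb-· a []      []      = sym (·-zeroʳ a)
  lincomb-· a (x ∷ c) (b ∷ B) =
    trans (cong₂ _⊕_ (sym (·-assoc a x b)) (lincomb-· a c B)) (sym (·-distribˡ a (x · b) (lincomb c B)))

  lincomb-⊝ : ∀ {v d} (c c' : Vec Carrier d) (B : Vec (Vector v) d) →
              lincomb (c ⊝ c') B ≡ lincomb c B ⊝ lincomb c' B
  lincomb-⊝ c c' B = begin
      lincomb (c ⊕ (⊖ c')) B                  ≡⟨ lincomb-⊕ c (⊖ c') B ⟩
      lincomb c B ⊕ lincomb (⊖ c') B          ≡⟨ cong (λ z → lincomb c B ⊕ lincomb z B) (⊖≡-1· c') ⟩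
      lincomb c B ⊕ lincomb ((- 1#) · c') B   ≡⟨ cong (lincomb c B ⊕_) (lincomb-· (- 1#) c' B) ⟩
      lincomb c B ⊕ ((- 1#) · lincomb c' B)   ≡⟨ cong (lincomb c B ⊕_) (sym (⊖≡-1· (lincomb c' B))) ⟩
      lincomb c B ⊕ (⊖ lincomb c' B)          ∎
    where open ≡-Reasoning

  lincomb-injective : ∀ {v d} (B : Vec (Vector v) d) → LinIndep B →
                      ∀ c c' → lincomb c B ≡ lincomb c' B → c ≡ c'
  lincomb-injective B indep c c' e = ⊝≡0⇒≡ c c' (indep (c ⊝ c') (begin
      lincomb (c ⊝ c') B           ≡⟨ lincomb-⊝ c c' B ⟩
      lincomb c B ⊝ lincomb c' B   ≡⟨ cong (_⊝ lincomb c' B) e ⟩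
      lincomb c' B ⊝ lincomb c' B  ≡⟨ ⊝-self (lincomb c' B) ⟩
      zeroV                        ∎))
    where open ≡-Reasoning

  ∈-zero : ∀ {v} (U : Subspace v) → zeroV ∈ₛ U
  ∈-zero U = zeroV , lincomb-zero (basis U)

  ∈-⊕ : ∀ {v} (U : Subspace v) {x y} → x ∈ₛ U → y ∈ₛ U → (x ⊕ y) ∈ₛ U
  ∈-⊕ U (c , e) (c' , e') = (c ⊕ c') , trans (lincomb-⊕ c c' (basis U)) (cong₂ _⊕_ e e')

  ∈-· : ∀ {v} (U : Subspace v) a {x} → x ∈ₛ U → (a · x) ∈ₛ U
  ∈-· U a (c , e) = (a · c) , trans (lincomb-· a c (basis U)) (cong (a ·_) e)

  ∈-⊝ : ∀ {v} (U : Subspace v) {x y} → x ∈ₛ U → y ∈ₛ U → (x ⊝ y) ∈ₛ U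
  ∈-⊝ U {y = y} x∈U y∈U = ∈-⊕ U x∈U (subst (_∈ₛ U) (sym (⊖≡-1· y)) (∈-· U (- 1#) y∈U))

module _ where
  open import Data.Nat.Divisibility using (_∣_; divides; _∣0; ∣m∣n⇒∣m+n; *-cancelʳ-∣)

  ∣-Σl : {A : Set} (c : ℕ) (f : A → ℕ) (xs : List A) → (∀ i → c ∣ f (lookup xs i)) → c ∣ Σl f xs
  ∣-Σl c f []       _   = c ∣0
  ∣-Σl c f (x ∷ xs) c∣f = ∣m∣n⇒∣m+n (c∣f zero) (∣-Σl c f xs (λ i → c∣f (suc i)))

  ^-∣ : ∀ q {a b} → a ≤ b → q ^ a ∣ q ^ b
  ^-∣ q {a} {b} a≤b =
    divides (q ^ (b ∸ a)) (trans (cong (q ^_) (sym (m∸n+n≡m a≤b))) (^-distribˡ-+-* q (b ∸ a) a))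

  power-cancel : ∀ q .{{_ : NonZero q}} {a b n} → 1 ≤ a → a ≤ b →
                 q ^ (b ∸ 1) ∣ n * q ^ (a ∸ 1) → q ^ (b ∸ a) ∣ n
  power-cancel q {a} {b} {n} 1≤a a≤b divisible =
    *-cancelʳ-∣ (q ^ (a ∸ 1)) {{m^n≢0 q (a ∸ 1)}} (subst (_∣ n * q ^ (a ∸ 1)) split divisible)
    where
      exponents : b ∸ 1 ≡ (b ∸ a) + (a ∸ 1)
      exponents = trans (cong (_∸ 1) (sym (m∸n+n≡m a≤b))) (+-∸-assoc (b ∸ a) 1≤a)
      split : q ^ (b ∸ 1) ≡ q ^ (b ∸ a) * q ^ (a ∸ 1)
      split = trans (cong (q ^_) exponents) (^-distribˡ-+-* q (b ∸ a) (a ∸ 1))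

above-second : ∀ {k} (d : Fin (suc (suc k)) → ℕ) → (∀ i j → i Fin.< j → d i < d j) →
               ∀ {n} → (∃ λ j → n ≡ d j) → n ≢ d zero → d (suc zero) ≤ n
above-second d increasing (zero , n≡d₀)             n≢d₀ = ⊥-elim (n≢d₀ n≡d₀)
above-second d increasing (suc zero , n≡d₁)         _    = ≤-reflexive (sym n≡d₁)
above-second d increasing (suc (suc j) , n≡dⱼ₊₂)    _    =
  subst (d (suc zero) ≤_) (sym n≡dⱼ₊₂) (<⇒≤ (increasing (suc zero) (suc (suc j)) (s≤s (s≤s z≤n))))

+[m+n]-+m≡+n : ∀ m n → ℤ.+ (m + n) ℤ.- ℤ.+ m ≡ ℤ.+ n
+[m+n]-+m≡+n m n = trans (ℤₚ.[+m]-[+n]≡m⊖n (m + n) m)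
                         (trans (ℤₚ.⊖-≥ (m≤m+n m n)) (cong ℤ.+_ (m+n∸m≡n m n)))

witness-of-filter : {A : Set} {P : A → Set} (P? : ∀ x → Dec (P x)) (xs : List A) →
                    0 < length (filter P? xs) → ∃ P
witness-of-filter P? xs = first (filter P? xs) (all-filter P? xs)
  where
    first : ∀ ys → All _ ys → 0 < length ys → ∃ _
    first (y ∷ _) (Py ∷ _) _ = y , Py

module Counting {q : ℕ} (𝔽 : FiniteField q) where
  open FiniteField 𝔽 using (Carrier; 0#; 1#; 0≢1; inverse; enum; isCommutativeRing)
  open VectorSpace 𝔽
  open VectorEnumeration 𝔽
  open LinearAlgebra 𝔽
  open import Data.Nat.Divisibility using (_∣_; _∣0; ∣-trans; ∣m+n∣m⇒∣n; n∣m*n)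
  private
    module F = IsCommutativeRing isCommutativeRing

  -- A field has the two distinct elements 0 and 1, so q ≥ 2.
  q≥2 : ∃ λ p → q ≡ suc (suc p)
  q≥2 = two-elements q (from 0#) (from 1#)
          (λ e → 0≢1 (trans (sym (strictlyInverseˡ 0#)) (trans (cong to e) (strictlyInverseˡ 1#))))
    where
      open Inverse enum using (to; from; strictlyInverseˡ)
      two-elements : ∀ n → (a b : Fin n) → a ≢ b → ∃ λ p → n ≡ suc (suc p)
      two-elements (suc zero)    zero zero a≢b = ⊥-elim (a≢b refl)
      two-elements (suc (suc p)) _    _    _   = p , refl

  -- q - 1, written as a successor so that it is visibly non-zero
  q-1 : ℕ
  q-1 = suc (proj₁ q≥2)

  q≡1+q-1 : q ≡ suc q-1
  q≡1+q-1 = proj₂ q≥2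

  instance
    q-nonZero : NonZero q
    q-nonZero = subst NonZero (sym q≡1+q-1) _

  Σᵥ : ∀ {v} → (Vector v → ℕ) → ℕ
  Σᵥ {v} f = Σl f (vectors v)

  -- The span of d independent vectors has q^d elements: the coefficient map F_q^d → F_q^v
  -- is injective.
  span-size : ∀ {v d} (B : Vec (Vector v) d) → LinIndep B →
              Σᵥ (λ x → ind (anyV? d (λ c → lincomb c B ≟V x))) ≡ q ^ d
  span-size {v} {d} B B-indep =
    trans (image-count _≟V_ _≟V_ {vectors v} {vectors d} (vectors-enum v) (vectors-enum d)
             (λ c → lincomb c B) (lincomb-injective B B-indep) _ (λ x x∈span → x∈span) (λ c → c , refl))
          (vectors-length d)

  subspace-size : ∀ {v} (U : Subspace v) → Σᵥ (λ x → ind (x ∈ₛ? U)) ≡ q ^ dim U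
  subspace-size U = span-size (basis U) (indep U)

  -- Comparing |U| ≤ |F_q^v| with q ≥ 2 shows dim U ≤ v.
  dim≤ : ∀ {v} (U : Subspace v) → dim U ≤ v
  dim≤ {v} U = ≮⇒≥ (λ v<dim → <⇒≱ (^-monoʳ-< q 1<q v<dim) |U|≤q^v)
    where
      1<q : 1 < q
      1<q = subst (1 <_) (sym q≡1+q-1) (s≤s (s≤s z≤n))
      |U|≤q^v : q ^ dim U ≤ q ^ v
      |U|≤q^v = subst₂ _≤_ (subspace-size U) (vectors-length v) (Σl-ind≤ (_∈ₛ? U) (vectors v))

  vector-outside : ∀ {v} (U H : Subspace v) → ¬ (U ≤ₛ H) → ∃ λ u → u ∈ₛ U × ¬ (u ∈ₛ H)
  vector-outside U H U≰H with anyV? (dim U) (λ c → ¬? (lincomb c (basis U) ∈ₛ? H))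
  ... | yes (c , ∉H) = lincomb c (basis U) , (c , refl) , ∉H
  ... | no none      = ⊥-elim (U≰H (λ x (c , e) → subst (_∈ₛ H) e
                         (decidable-stable (lincomb c (basis U) ∈ₛ? H) (λ ∉H → none (c , ∉H)))))

  inside outside : ∀ {v} (H U : Subspace v) → ℕ
  inside  H U = Σᵥ (λ x → ind ((x ∈ₛ? U) ×-dec (x ∈ₛ? H)))
  outside H U = Σᵥ (λ x → ind ((x ∈ₛ? U) ×-dec ¬? (x ∈ₛ? H)))

  -- Given a hyperplane H and u ∉ H, F_q^v is the disjoint union of the q layers
  -- a·u + H (a ∈ F_q).
  module Layers {v} (H : Subspace v) (hyp : IsHyperplane H) (u : Vector v) (u∉H : ¬ (u ∈ₛ H)) where

    extendedBasis : Vec (Vector v) (suc (dim H))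
    extendedBasis = u ∷ basis H

    -- If a·u + h = 0 with h ∈ H and a ≠ 0, then u = a⁻¹·(a·u) ∈ H; so a = 0 and then h = 0.
    extendedBasis-indep : LinIndep extendedBasis
    extendedBasis-indep (a ∷ c) e with a ≟F 0#
    ... | yes refl = cong (0# ∷_) (indep H c (begin
        lincomb c (basis H)                ≡⟨ sym (⊕-identityˡ _) ⟩
        zeroV ⊕ lincomb c (basis H)        ≡⟨ cong (_⊕ lincomb c (basis H)) (sym (·-zeroˡ u)) ⟩
        (0# · u) ⊕ lincomb c (basis H)     ≡⟨ e ⟩
        zeroV                              ∎))
      where open ≡-Reasoning
    ... | no a≢0 = ⊥-elim (u∉H u∈H)
      where
        h : Vector v
        h = lincomb c (basis H)
        a⁻¹ : Carrier
        a⁻¹ = proj₁ (inverse a a≢0)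
        au∈H : (a · u) ∈ₛ H
        au∈H = subst (_∈ₛ H) (trans (cong (_⊝ h) (sym e)) (⊕-⊝-cancel (a · u) h))
                     (∈-⊝ H (∈-zero H) (c , refl))
        a⁻¹·au≡u : a⁻¹ · (a · u) ≡ u
        a⁻¹·au≡u = trans (·-assoc a⁻¹ a u)
                   (trans (cong (_· u) (trans (F.*-comm a⁻¹ a) (proj₂ (inverse a a≢0)))) (·-identity u))
        u∈H : u ∈ₛ H
        u∈H = subst (_∈ₛ H) a⁻¹·au≡u (∈-· H a⁻¹ au∈H)

    -- The q^v combinations of the extended basis are distinct, hence exhaust F_q^v.
    extendedBasis-spans : ∀ x → ∃ λ c → lincomb c extendedBasis ≡ x
    extendedBasis-spans = Enumeration.full⇒all _≟V_ {vectors v} (vectors-enum v) _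
      (begin
        Σᵥ (λ x → ind (anyV? (suc (dim H)) (λ c → lincomb c extendedBasis ≟V x)))
          ≡⟨ span-size extendedBasis extendedBasis-indep ⟩
        q ^ suc (dim H)      ≡⟨ cong (q ^_) hyp ⟩
        q ^ v                ≡⟨ sym (vectors-length v) ⟩
        length (vectors v)   ∎)
      where open ≡-Reasoning

    OnLayer? : ∀ a x → Dec ((x ⊝ (a · u)) ∈ₛ H)
    OnLayer? a x = (x ⊝ (a · u)) ∈ₛ? H

    layer-exists : ∀ x → ∃ λ a → (x ⊝ (a · u)) ∈ₛ H
    layer-exists x with extendedBasis-spans x
    ... | (a ∷ c) , e = a , c , (begin
        lincomb c (basis H)                           ≡⟨ sym (⊕-⊝-cancel _ (a · u)) ⟩
        (lincomb c (basis H) ⊕ (a · u)) ⊝ (a · u)     ≡⟨ cong (_⊝ (a · u)) (trans (⊕-comm _ _) e) ⟩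
        x ⊝ (a · u)                                   ∎)
      where open ≡-Reasoning

    layer-unique : ∀ {a b x} → (x ⊝ (a · u)) ∈ₛ H → (x ⊝ (b · u)) ∈ₛ H → a ≡ b
    layer-unique {a} {b} {x} (c , e) (c' , e') =
      cong Vec.head (lincomb-injective extendedBasis extendedBasis-indep (a ∷ c) (b ∷ c')
                       (trans (recombine a c e) (sym (recombine b c' e'))))
      where
        recombine : ∀ a c → lincomb c (basis H) ≡ x ⊝ (a · u) → lincomb (a ∷ c) extendedBasis ≡ x
        recombine a c e = trans (cong ((a · u) ⊕_) e) (trans (⊕-comm (a · u) _) (⊝-⊕-cancel x (a · u)))

    one-layer : ∀ x → Σl (λ a → ind (OnLayer? a x)) fieldElements ≡ 1
    one-layer x =
      Enumeration.count-unique _≟F_ {fieldElements} fieldElements-enum (λ a → OnLayer? a x)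
        (proj₁ (layer-exists x)) (λ b on-b → layer-unique on-b (proj₂ (layer-exists x)))
        (proj₂ (layer-exists x))

    module _ (U : Subspace v) (u∈U : u ∈ₛ U) where

      onLayer : Carrier → ℕ
      onLayer a = Σᵥ (λ x → ind ((x ∈ₛ? U) ×-dec OnLayer? a x))

      -- Translation y ↦ y + a·u maps U ∩ H bijectively onto the part of U on layer a.
      onLayer≡inside : ∀ a → onLayer a ≡ inside H U
      onLayer≡inside a = begin
          onLayer a
            ≡⟨ Enumeration.reindex _≟V_ {vectors v} (vectors-enum v) (_⊕ (a · u)) (_⊝ (a · u))
                 (λ x → ⊝-⊕-cancel x (a · u)) (λ y → ⊕-⊝-cancel y (a · u)) _ ⟩
          Σᵥ (λ y → ind (((y ⊕ (a · u)) ∈ₛ? U) ×-dec OnLayer? a (y ⊕ (a · u))))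
            ≡⟨ Σl-cong (vectors v) (λ y → ind-cong _ _ (translate⁻¹ y) (translate y)) ⟩
          inside H U ∎
        where
          open ≡-Reasoning
          translate : ∀ y → y ∈ₛ U × y ∈ₛ H → (y ⊕ (a · u)) ∈ₛ U × ((y ⊕ (a · u)) ⊝ (a · u)) ∈ₛ H
          translate y (y∈U , y∈H) =
            ∈-⊕ U y∈U (∈-· U a u∈U) , subst (_∈ₛ H) (sym (⊕-⊝-cancel y (a · u))) y∈H
          translate⁻¹ : ∀ y → (y ⊕ (a · u)) ∈ₛ U × ((y ⊕ (a · u)) ⊝ (a · u)) ∈ₛ H → y ∈ₛ U × y ∈ₛ H
          translate⁻¹ y (y+au∈U , on) =
            subst (_∈ₛ U) (⊕-⊝-cancel y (a · u)) (∈-⊝ U y+au∈U (∈-· U a u∈U)) ,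
            subst (_∈ₛ H) (⊕-⊝-cancel y (a · u)) on

      -- Each vector of U is on exactly one of the q layers, each meeting U in |U ∩ H| vectors.
      layered-size : Σᵥ (λ x → ind (x ∈ₛ? U)) ≡ q * inside H U
      layered-size = begin
          Σᵥ (λ x → ind (x ∈ₛ? U))
            ≡⟨ Σl-cong (vectors v) on-its-layer ⟩
          Σᵥ (λ x → Σl (λ a → ind ((x ∈ₛ? U) ×-dec OnLayer? a x)) fieldElements)
            ≡⟨ Σl-swap _ (vectors v) fieldElements ⟩
          Σl onLayer fieldElements                ≡⟨ Σl-cong fieldElements onLayer≡inside ⟩
          Σl (λ _ → inside H U) fieldElements     ≡⟨ Σl-const _ fieldElements ⟩
          length fieldElements * inside H U       ≡⟨ cong (_* inside H U) fieldElements-length ⟩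
          q * inside H U                          ∎
        where
          open ≡-Reasoning
          on-its-layer : ∀ x → ind (x ∈ₛ? U) ≡ Σl (λ a → ind ((x ∈ₛ? U) ×-dec OnLayer? a x)) fieldElements
          on-its-layer x = begin
              ind (x ∈ₛ? U)
                ≡⟨ sym (*-identityʳ _) ⟩
              ind (x ∈ₛ? U) * 1
                ≡⟨ cong (ind (x ∈ₛ? U) *_) (sym (one-layer x)) ⟩
              ind (x ∈ₛ? U) * Σl (λ a → ind (OnLayer? a x)) fieldElements
                ≡⟨ sym (Σl-*ˡ (ind (x ∈ₛ? U)) _ fieldElements) ⟩
              Σl (λ a → ind (x ∈ₛ? U) * ind (OnLayer? a x)) fieldElements
                ≡⟨ Σl-cong fieldElements (λ a → sym (ind-× (x ∈ₛ? U) (OnLayer? a x))) ⟩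
              Σl (λ a → ind ((x ∈ₛ? U) ×-dec OnLayer? a x)) fieldElements ∎

  inside+outside : ∀ {v} (H U : Subspace v) → Σᵥ (λ x → ind (x ∈ₛ? U)) ≡ inside H U + outside H U
  inside+outside {v} H U =
    trans (Σl-cong (vectors v) (λ x → ind-split (x ∈ₛ? U) (x ∈ₛ? H))) (Σl-+ _ _ (vectors v))

  -- If U ⊄ H then |U ∩ H| = q^(dim U - 1), hence |U \ H| = (q-1)·q^(dim U - 1).
  outside-count-≰ : ∀ {v} (H : Subspace v) → IsHyperplane H → (U : Subspace v) → 1 ≤ dim U →
                    ¬ (U ≤ₛ H) → outside H U ≡ q-1 * q ^ (dim U ∸ 1)
  outside-count-≰ H hyp U 1≤dim U≰H = +-cancelˡ-≡ (q ^ e) _ _ (begin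
      q ^ e + outside H U        ≡⟨ cong (_+ outside H U) (sym inside≡) ⟩
      inside H U + outside H U   ≡⟨ sym (inside+outside H U) ⟩
      Σᵥ (λ x → ind (x ∈ₛ? U))   ≡⟨ size ⟩
      q * q ^ e                  ≡⟨ cong (_* q ^ e) q≡1+q-1 ⟩
      q ^ e + q-1 * q ^ e        ∎)
    where
      open ≡-Reasoning
      e : ℕ
      e = dim U ∸ 1
      outside-vector : ∃ λ u → u ∈ₛ U × ¬ (u ∈ₛ H)
      outside-vector = vector-outside U H U≰H
      open Layers H hyp (proj₁ outside-vector) (proj₂ (proj₂ outside-vector))
      size : Σᵥ (λ x → ind (x ∈ₛ? U)) ≡ q * q ^ e
      size = trans (subspace-size U) (cong (q ^_) (sym (trans (+-comm 1 e) (m∸n+n≡m 1≤dim))))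
      inside≡ : inside H U ≡ q ^ e
      inside≡ = *-cancelˡ-≡ _ _ q (trans (sym (layered-size U (proj₁ (proj₂ outside-vector)))) size)

  weight : ∀ {v} (H U : Subspace v) → ℕ
  weight H U = ind (¬? (U ≤ₛ? H)) * q ^ (dim U ∸ 1)

  outside-count : ∀ {v} (H : Subspace v) → IsHyperplane H → (U : Subspace v) → 1 ≤ dim U →
                  outside H U ≡ q-1 * weight H U
  outside-count {v} H hyp U 1≤dim with U ≤ₛ? H
  ... | yes U≤H = trans (Σl-0 _ (vectors v) (λ x → ind-no _ (λ (x∈U , x∉H) → x∉H (U≤H x x∈U))))
                        (sym (*-zeroʳ q-1))
  ... | no U≰H  = trans (outside-count-≰ H hyp U 1≤dim U≰H) (cong (q-1 *_) (sym (*-identityˡ _)))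

  complement-count : ∀ {v} (H : Subspace v) → IsHyperplane H →
                     Σᵥ (λ x → ind (¬? (x ∈ₛ? H))) ≡ q-1 * q ^ dim H
  complement-count {v} H hyp = +-cancelˡ-≡ (q ^ dim H) _ _ (begin
      q ^ dim H + Σᵥ (λ x → ind (¬? (x ∈ₛ? H)))
        ≡⟨ cong (_+ Σᵥ (λ x → ind (¬? (x ∈ₛ? H)))) (sym (subspace-size H)) ⟩
      Σᵥ (λ x → ind (x ∈ₛ? H)) + Σᵥ (λ x → ind (¬? (x ∈ₛ? H)))
        ≡⟨ sym (Σl-+ _ _ (vectors v)) ⟩
      Σᵥ (λ x → ind (x ∈ₛ? H) + ind (¬? (x ∈ₛ? H)))
        ≡⟨ Σl-cong (vectors v) (λ x → ind-compl (x ∈ₛ? H)) ⟩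
      Σᵥ {v} (λ _ → 1)
        ≡⟨ trans (Σl-1 (vectors v)) (vectors-length v) ⟩
      q ^ v
        ≡⟨ cong (q ^_) (sym hyp) ⟩
      q * q ^ dim H
        ≡⟨ cong (_* q ^ dim H) q≡1+q-1 ⟩
      q ^ dim H + q-1 * q ^ dim H ∎)
    where open ≡-Reasoning

  -- Each vector outside H lies in exactly one element of the partition P.
  partition-count : ∀ {v} (P : List (Subspace v)) → IsVSP P → (H : Subspace v) →
                    Σᵥ (λ x → ind (¬? (x ∈ₛ? H))) ≡ Σl (outside H) P
  partition-count {v} P (_ , covers) H =
    trans (Σl-cong (vectors v) in-one-element)
          (Σl-swap (λ x U → ind ((x ∈ₛ? U) ×-dec ¬? (x ∈ₛ? H))) (vectors v) P)
    where
      outside⇒nonzero : ∀ {x} → ¬ (x ∈ₛ H) → x ≢ zeroV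
      outside⇒nonzero x∉H x≡0 = x∉H (subst (_∈ₛ H) (sym x≡0) (∈-zero H))

      in-one-element : ∀ x → ind (¬? (x ∈ₛ? H)) ≡ Σl (λ U → ind ((x ∈ₛ? U) ×-dec ¬? (x ∈ₛ? H))) P
      in-one-element x with x ∈ₛ? H
      ... | yes x∈H = sym (Σl-0 _ P (λ U → ind-no _ (λ (_ , x∉H) → x∉H x∈H)))
      ... | no x∉H  =
        let (i , x∈Pᵢ , only-i) = covers x (outside⇒nonzero x∉H) in
        sym (trans (Σl-cong P (λ U → ind-cong _ (x ∈ₛ? U) proj₁ (λ x∈U → x∈U , x∉H)))
                   (count-unique-position (x ∈ₛ?_) P i x∈Pᵢ only-i))

  -- Double counting the vectors outside H:  q^(v-1) = Σ_{U ∈ P} weight H U.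
  weight-sum : ∀ {v} (P : List (Subspace v)) → IsVSP P → (H : Subspace v) → IsHyperplane H →
               q ^ dim H ≡ Σl (weight H) P
  weight-sum P vsp H hyp = *-cancelˡ-≡ _ _ q-1 (begin
      q-1 * q ^ dim H                ≡⟨ sym (complement-count H hyp) ⟩
      Σᵥ (λ x → ind (¬? (x ∈ₛ? H)))  ≡⟨ partition-count P vsp H ⟩
      Σl (outside H) P               ≡⟨ Σl-cong-on P (λ i → outside-count H hyp (lookup P i) (proj₁ vsp i)) ⟩
      Σl (λ U → q-1 * weight H U) P  ≡⟨ Σl-*ˡ q-1 (weight H) P ⟩
      q-1 * Σl (weight H) P          ∎)
    where open ≡-Reasoning

  countDimOut : ∀ {v} → List (Subspace v) → ℕ → Subspace v → ℕ
  countDimOut P d H = Σl (λ U → ind ((dim U ℕ.≟ d) ×-dec ¬? (U ≤ₛ? H))) P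

  countDim-difference : ∀ {v} (P : List (Subspace v)) d (H : Subspace v) →
                        ℤ.+ countDim P d ℤ.- ℤ.+ countDimIn P d H ≡ ℤ.+ countDimOut P d H
  countDim-difference P d H = trans (cong (λ n → ℤ.+ n ℤ.- ℤ.+ countDimIn P d H) split)
                                    (+[m+n]-+m≡+n (countDimIn P d H) (countDimOut P d H))
    where
      split : countDim P d ≡ countDimIn P d H + countDimOut P d H
      split = trans (length-filter≡Σl _ P)
              (trans (Σl-cong P (λ U → ind-split (dim U ℕ.≟ d) (U ≤ₛ? H)))
              (trans (Σl-+ _ _ P) (cong (_+ countDimOut P d H) (sym (length-filter≡Σl _ P)))))

  otherWeight : ∀ {v} → ℕ → Subspace v → Subspace v → ℕ
  otherWeight d H U = ind (¬? (dim U ℕ.≟ d)) * weight H U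

  weight-split : ∀ {v} d (H U : Subspace v) →
                 weight H U ≡ otherWeight d H U + ind ((dim U ℕ.≟ d) ×-dec ¬? (U ≤ₛ? H)) * q ^ (d ∸ 1)
  weight-split d H U with dim U ℕ.≟ d | U ≤ₛ? H
  ... | yes refl | yes _ = refl
  ... | yes refl | no _  = refl
  ... | no _     | _     = sym (trans (+-identityʳ _) (+-identityʳ _))

  otherWeight-divisible : ∀ {v} d {b} (H U : Subspace v) → (dim U ≢ d → b ≤ dim U) →
                          q ^ (b ∸ 1) ∣ otherWeight d H U
  otherWeight-divisible d H U large with dim U ℕ.≟ d
  ... | yes _   = _ ∣0
  ... | no dim≢d = ∣-trans (^-∣ q (∸-monoˡ-≤ 1 (large dim≢d)))
                           (∣-trans (n∣m*n (ind (¬? (U ≤ₛ? H)))) (n∣m*n 1))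

  -- If every element of P has dimension d₁ or at least d₂, where 1 ≤ d₁ < d₂ ≤ v,
  -- then q^(d₂-d₁) divides the number of d₁-dimensional elements outside the hyperplane H:
  -- q^(d₂-1) divides q^(v-1) = otherWeight + N·q^(d₁-1) and every term of otherWeight.
  hyperplane-divisibility :
    ∀ {v} (P : List (Subspace v)) → IsVSP P → (H : Subspace v) → IsHyperplane H →
    ∀ {d₁ d₂} → 1 ≤ d₁ → d₁ < d₂ → d₂ ≤ v →
    (∀ i → dim (lookup P i) ≢ d₁ → d₂ ≤ dim (lookup P i)) →
    q ^ (d₂ ∸ d₁) ∣ countDimOut P d₁ H
  hyperplane-divisibility P vsp H hyp {d₁} {d₂} 1≤d₁ d₁<d₂ d₂≤v gap =
    power-cancel q 1≤d₁ (<⇒≤ d₁<d₂) (∣m+n∣m⇒∣n divides-total divides-others)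
    where
      others : ℕ
      others = Σl (otherWeight d₁ H) P
      total≡ : q ^ dim H ≡ others + countDimOut P d₁ H * q ^ (d₁ ∸ 1)
      total≡ = trans (weight-sum P vsp H hyp)
               (trans (Σl-cong P (weight-split d₁ H))
               (trans (Σl-+ _ _ P) (cong (others +_) (Σl-*ʳ (q ^ (d₁ ∸ 1)) _ P))))
      d₂-1≤dimH : d₂ ∸ 1 ≤ dim H
      d₂-1≤dimH = subst (d₂ ∸ 1 ≤_) (cong (_∸ 1) (sym hyp)) (∸-monoˡ-≤ 1 d₂≤v)
      divides-total : q ^ (d₂ ∸ 1) ∣ others + countDimOut P d₁ H * q ^ (d₁ ∸ 1)
      divides-total = subst (q ^ (d₂ ∸ 1) ∣_) total≡ (^-∣ q d₂-1≤dimH)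
      divides-others : q ^ (d₂ ∸ 1) ∣ others
      divides-others = ∣-Σl _ _ P (λ i → otherWeight-divisible d₁ H (lookup P i) (gap i))

  occurring-dim≤ : ∀ {v} (P : List (Subspace v)) d → 0 < countDim P d → d ≤ v
  occurring-dim≤ P d occurs with witness-of-filter (λ U → dim U ℕ.≟ d) P occurs
  ... | U , dimU≡d = subst (_≤ _) dimU≡d (dim≤ U)

open import Data.Fin using () renaming (_<_ to _<ᶠ_)
open import Data.Integer using (+_; _-_)
open import Data.Integer.Divisibility using (_∣_)

lemma2 : (q : ℕ) (𝔽 : FiniteField q) (v : ℕ) → 1 ≤ v →
    let open VectorSpace 𝔽 in
    (P : List (Subspace v)) → IsVSP P →
    -- type d_l^{u_l} ... d_2^{u_2} d_1^{u_1}, with l = k + 2 and index zero ↦ d_1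
    (k : ℕ) (d u : Fin (suc (suc k)) → ℕ) →
    (∀ i j → i <ᶠ j → d i < d j) →
    1 ≤ d zero →
    0 < u zero → 0 < u (suc zero) →
    (∀ j → countDim P (d j) ≡ u j) →
    (∀ i → ∃ λ j → dim (lookup P i) ≡ d j) →
    (H : Subspace v) → IsHyperplane H →
    + (q ^ (d (suc zero) ∸ d zero)) ∣ (+ countDim P (d zero) - + countDimIn P (d zero) H)
lemma2 q 𝔽 v _ P vsp _ d u increasing 1≤d₁ _ u₂>0 counts dims H hyp =
  subst (+ (q ^ (d₂ ∸ d₁)) ∣_) (sym (countDim-difference P d₁ H))
        (hyperplane-divisibility P vsp H hyp 1≤d₁ d₁<d₂ d₂≤v gap)
  where
    open VectorSpace 𝔽
    open Counting 𝔽
    d₁ d₂ : ℕ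
    d₁ = d zero
    d₂ = d (suc zero)
    d₁<d₂ : d₁ < d₂
    d₁<d₂ = increasing zero (suc zero) (s≤s z≤n)
    gap : ∀ i → dim (lookup P i) ≢ d₁ → d₂ ≤ dim (lookup P i)
    gap i = above-second d increasing (dims i)
    d₂≤v : d₂ ≤ v
    d₂≤v = occurring-dim≤ P d₂ (subst (0 <_) (sym (counts (suc zero))) u₂>0)
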